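{- Let $m, n$ be integers with $4 \leq m < n$, and let $G$ be any Wheel Random Apollonian Graph $WRAG(m,n)$. Then the number of $3$-cycles of $G$ is $|T(G)| = 3n - 8$ if $m = 4$, and $|T(G)| = 3n - 2m - 1$ if $m > 4$.
   Context: For an integer $m \geq 4$, the wheel graph $W_m(v_0)$ with hub $v_0$ has vertex set $\{v_0, v_1, \dots, v_{m-1}\}$ and edge set consisting of the spokes $v_0v_i$ for $i = 1, \dots, m-1$ together with the rim edges $v_iv_{i+1}$ for $i = 1, \dots, m-2$ and $v_{m-1}v_1$. A $3$-cycle of a graph $G$ is a cycle of length $3$ (a triangle), and $T(G)$ is the set of all $3$-cycles of $G$. A Wheel Random Apollonian Graph Sequence with seed $W_m(v_0)$ is the sequence $G_0, G_1, \dots$ with $G_0 = W_m(v_0)$ and $G_{i+1}$ obtained from $G_i$ by choosing (randomly) a $3$-cycle of $G_i$ not chosen at any previous step, adding one new vertex and joining it to the three vertices of the chosen $3$-cycle. $WRAG(m,n)$ (for $4 \leq m < n$) denotes the graph $G_{n-m}$ of such a sequence, for any choice of the selected $3$-cycles. -}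

module Defs where

open import Data.Nat using (ℕ; zero; suc; _+_; _*_; _∸_; _<ᵇ_; _≡ᵇ_)
open import Data.Bool using (Bool; true; false; _∧_; _∨_; if_then_else_)
open import Data.List using (List; []; _∷_; map; concatMap; filter; upTo; length; _++_)
open import Data.Bool.ListAction using (any)
open import Data.Product using (_×_; _,_)
open import Data.Unit using (⊤)
open import Data.List.Membership.Propositional using (_∈_; _∉_)
open import Relation.Nullary.Decidable using (Dec)
open import Data.Bool.Properties using (T?)
open import Data.Bool using (T)

-- A finite simple graph on the vertex set {0, …, size - 1}, given by its edge list.
record Graph : Set where
  constructor mkGraph
  field
    size  : ℕ
    edges : List (ℕ × ℕ)
open Graph public

adj : Graph → ℕ → ℕ → Bool
adj G u v = any (λ e → edgeIs e) (edges G)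
  where
  edgeIs : ℕ × ℕ → Bool
  edgeIs (a , b) = ((a ≡ᵇ u) ∧ (b ≡ᵇ v)) ∨ ((a ≡ᵇ v) ∧ (b ≡ᵇ u))

-- A 3-cycle {a,b,c} is represented canonically by the triple (a , b , c) with a < b < c.
Triple : Set
Triple = ℕ × ℕ × ℕ

isTriangle : Graph → Triple → Bool
isTriangle G (a , b , c) =
  (a <ᵇ b) ∧ (b <ᵇ c) ∧ (c <ᵇ size G) ∧ adj G a b ∧ adj G b c ∧ adj G a c

allTriples : ℕ → List Triple
allTriples k = concatMap (λ a → concatMap (λ b → map (λ c → (a , b , c)) (upTo k)) (upTo k)) (upTo k)

triangles : Graph → List Triple
triangles G = filter (λ t → T? (isTriangle G t)) (allTriples (size G))

-- The wheel W_m(v₀) with hub v₀ = 0 and rim vertices 1, …, m-1.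
wheel : ℕ → Graph
wheel m = mkGraph m (spokes ++ rim ++ ((m ∸ 1 , 1) ∷ []))
  where
  spokes : List (ℕ × ℕ)
  spokes = map (λ i → (0 , suc i)) (upTo (m ∸ 1))
  rim : List (ℕ × ℕ)
  rim = map (λ i → (suc i , suc (suc i))) (upTo (m ∸ 2))

extend : Graph → Triple → Graph
extend G (a , b , c) =
  mkGraph (suc (size G)) ((size G , a) ∷ (size G , b) ∷ (size G , c) ∷ edges G)

build : Graph → List Triple → Graph
build G []       = G
build G (t ∷ ts) = build (extend G t) ts

ValidChoices : Graph → List Triple → List Triple → Set
ValidChoices G used []       = ⊤
ValidChoices G used (t ∷ ts) =
  (t ∈ triangles G) × (t ∉ used) × ValidChoices (extend G t) (t ∷ used) ts

-- G is a WRAG(m,n): G = G_{n-m} of some Wheel Random Apollonian Graph Sequence with seed W_m.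
IsWRAG : ℕ → ℕ → Graph → Set
IsWRAG m n G = Data.Product.Σ (List Triple) λ ts →
  (length ts ≡ n ∸ m) × ValidChoices (wheel m) [] ts × (build (wheel m) ts ≡ G)
  where open import Relation.Binary.PropositionalEquality using (_≡_)

-- Count 3-cycles by their largest vertex: the 3-cycles on {0, …, k} are those on {0, …, k-1} plus
-- those topped at k, and if k has only two or three lower neighbours the latter are just the edges
-- among them. A vertex attached to a 3-cycle has exactly that cycle's vertices as neighbours, all
-- pairwise adjacent, so every step adds exactly three 3-cycles. In W_m (m ≥ 5) each rim vertex
-- 2, …, m-2 tops one 3-cycle (with the hub and its predecessor) and the last one tops two, so
-- |T(W_m)| = m - 1, whereas |T(W_4)| = |T(K_4)| = 4; hence |T(G)| = |T(W_m)| + 3 (n - m).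
module Submission where

open import Defs
open import Data.Bool using (Bool; true; false; _∧_; _∨_; T)
open import Data.Bool.ListAction using (any)
open import Data.Bool.Properties using (T?; T-≡; T-∧; ∧-zeroʳ; ∧-identityʳ; ∨-zeroʳ)
open import Data.Empty using (⊥-elim)
open import Data.List using (List; []; _∷_; map; concatMap; filter; upTo; applyUpTo; length; _++_)
open import Data.List.Membership.Propositional using (_∈_)
open import Data.List.Membership.Propositional.Properties
  using (∈-filter⁻; ∈-map⁺; ∈-map⁻; ∈-++⁺ˡ; ∈-++⁺ʳ; ∈-++⁻; ∈-upTo⁺; ∈-upTo⁻)
open import Data.List.Properties using (filter-++; length-++)
open import Data.List.Relation.Unary.Any using (here; there)
open import Data.Nat using (ℕ; zero; suc; _≤_; _<_; _*_; _+_; _∸_; _<ᵇ_; _≡ᵇ_; z≤n; s≤s; s≤s⁻¹; z<s)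
open import Data.Nat.Properties
open import Data.Nat.Tactic.RingSolver using (solve-∀)
open import Data.Product using (_×_; _,_; proj₁; proj₂)
open import Data.Sum using (_⊎_; inj₁; inj₂)
open import Function using (_∘_; id; Equivalence)
open import Relation.Binary.PropositionalEquality
open import Relation.Nullary using (yes; no)

sumBelow : ℕ → (ℕ → ℕ) → ℕ
sumBelow zero    f = 0
sumBelow (suc k) f = sumBelow k f + f k

syntax sumBelow k (λ i → e) = ∑[ i < k ] e

restrict : ∀ {k} (P : ℕ → Set) → (∀ i → i < suc k → P i) → ∀ i → i < k → P i
restrict P h i i<k = h i (m<n⇒m<1+n i<k)

sumBelow-cong : ∀ k {f g : ℕ → ℕ} → (∀ i → i < k → f i ≡ g i) → sumBelow k f ≡ sumBelow k g
sumBelow-cong zero    f≗g = refl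
sumBelow-cong (suc k) f≗g = cong₂ _+_ (sumBelow-cong k (restrict _ f≗g)) (f≗g k (n<1+n k))

sumBelow-zero : ∀ k {f} → (∀ i → i < k → f i ≡ 0) → sumBelow k f ≡ 0
sumBelow-zero zero    f≗0 = refl
sumBelow-zero (suc k) f≗0 = cong₂ _+_ (sumBelow-zero k (restrict _ f≗0)) (f≗0 k (n<1+n k))

sumBelow-distrib-+ : ∀ k f g → ∑[ i < k ] (f i + g i) ≡ sumBelow k f + sumBelow k g
sumBelow-distrib-+ zero    f g = refl
sumBelow-distrib-+ (suc k) f g rewrite sumBelow-distrib-+ k f g = interchange (sumBelow k f) (sumBelow k g) (f k) (g k)
  where
  interchange : ∀ a b c d → a + b + (c + d) ≡ a + c + (b + d)
  interchange = solve-∀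

sumBelow-unfoldˡ : ∀ k f → sumBelow (suc k) f ≡ f 0 + ∑[ i < k ] f (suc i)
sumBelow-unfoldˡ zero    f = +-comm 0 (f 0)
sumBelow-unfoldˡ (suc k) f = trans (cong (_+ f (suc k)) (sumBelow-unfoldˡ k f)) (+-assoc (f 0) _ _)

sumBelow-support₁ : ∀ k f {p} → p < k → (∀ i → i < k → i ≢ p → f i ≡ 0) → sumBelow k f ≡ f p
sumBelow-support₁ (suc k) f {p} p<1+k f≗0 with p ≟ k
... | yes refl = cong (_+ f p) (sumBelow-zero k λ i i<k → f≗0 i (m<n⇒m<1+n i<k) (<⇒≢ i<k))
... | no  p≢k  = trans (cong₂ _+_ (sumBelow-support₁ k f (≤∧≢⇒< (s≤s⁻¹ p<1+k) p≢k) (restrict _ f≗0))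
                                  (f≗0 k (n<1+n k) (p≢k ∘ sym)))
                       (+-identityʳ (f p))

sumBelow-support₂ : ∀ k f {p q} → p < q → q < k → (∀ i → i < k → i ≢ p → i ≢ q → f i ≡ 0) →
                    sumBelow k f ≡ f p + f q
sumBelow-support₂ (suc k) f {p} {q} p<q q<1+k f≗0 with q ≟ k
... | yes refl = cong (_+ f q) (sumBelow-support₁ k f p<q λ i i<k i≢p → f≗0 i (m<n⇒m<1+n i<k) i≢p (<⇒≢ i<k))
... | no  q≢k  = trans (cong₂ _+_ (sumBelow-support₂ k f p<q q<k (restrict _ f≗0))
                                  (f≗0 k (n<1+n k) (<⇒≢ (<-trans p<q q<k) ∘ sym) (q≢k ∘ sym)))
                       (+-identityʳ _)
  where
  q<k : q < k
  q<k = ≤∧≢⇒< (s≤s⁻¹ q<1+k) q≢k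

sumBelow-support₃ : ∀ k f {p q r} → p < q → q < r → r < k →
                    (∀ i → i < k → i ≢ p → i ≢ q → i ≢ r → f i ≡ 0) →
                    sumBelow k f ≡ f p + f q + f r
sumBelow-support₃ (suc k) f {p} {q} {r} p<q q<r r<1+k f≗0 with r ≟ k
... | yes refl = cong (_+ f r) (sumBelow-support₂ k f p<q q<r λ i i<k i≢p i≢q → f≗0 i (m<n⇒m<1+n i<k) i≢p i≢q (<⇒≢ i<k))
... | no  r≢k  = trans (cong₂ _+_ (sumBelow-support₃ k f p<q q<r r<k (restrict _ f≗0))
                                  (f≗0 k (n<1+n k) (<⇒≢ (<-trans (<-trans p<q q<r) r<k) ∘ sym)
                                       (<⇒≢ (<-trans q<r r<k) ∘ sym) (r≢k ∘ sym)))
                       (+-identityʳ _)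
  where
  r<k : r < k
  r<k = ≤∧≢⇒< (s≤s⁻¹ r<1+k) r≢k

toℕ : Bool → ℕ
toℕ false = 0
toℕ true  = 1

module _ {A : Set} (p : A → Bool) where

  length-filter-∷ : ∀ x xs → length (filter (T? ∘ p) (x ∷ xs)) ≡ toℕ (p x) + length (filter (T? ∘ p) xs)
  length-filter-∷ x xs with p x
  ... | true  = refl
  ... | false = refl

  length-filter-map : ∀ (g : ℕ → A) n f →
    length (filter (T? ∘ p) (map g (applyUpTo f n))) ≡ ∑[ i < n ] toℕ (p (g (f i)))
  length-filter-map g zero    f = refl
  length-filter-map g (suc n) f = begin
      length (filter (T? ∘ p) (map g (applyUpTo f (suc n))))
    ≡⟨ length-filter-∷ (g (f 0)) _ ⟩
      toℕ (p (g (f 0))) + length (filter (T? ∘ p) (map g (applyUpTo (f ∘ suc) n)))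
    ≡⟨ cong (toℕ (p (g (f 0))) +_) (length-filter-map g n (f ∘ suc)) ⟩
      toℕ (p (g (f 0))) + ∑[ i < n ] toℕ (p (g (f (suc i))))
    ≡⟨ sumBelow-unfoldˡ n _ ⟨
      ∑[ i < suc n ] toℕ (p (g (f i))) ∎
    where open ≡-Reasoning

  length-filter-concatMap : ∀ (h : ℕ → List A) n f →
    length (filter (T? ∘ p) (concatMap h (applyUpTo f n))) ≡ ∑[ i < n ] length (filter (T? ∘ p) (h (f i)))
  length-filter-concatMap h zero    f = refl
  length-filter-concatMap h (suc n) f = begin
      length (filter (T? ∘ p) (h (f 0) ++ concatMap h (applyUpTo (f ∘ suc) n)))
    ≡⟨ cong length (filter-++ (T? ∘ p) (h (f 0)) _) ⟩
      length (filter (T? ∘ p) (h (f 0)) ++ filter (T? ∘ p) (concatMap h (applyUpTo (f ∘ suc) n)))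
    ≡⟨ length-++ (filter (T? ∘ p) (h (f 0))) ⟩
      count (h (f 0)) + length (filter (T? ∘ p) (concatMap h (applyUpTo (f ∘ suc) n)))
    ≡⟨ cong (count (h (f 0)) +_) (length-filter-concatMap h n (f ∘ suc)) ⟩
      count (h (f 0)) + ∑[ i < n ] count (h (f (suc i)))
    ≡⟨ sumBelow-unfoldˡ n _ ⟨
      ∑[ i < suc n ] count (h (f i)) ∎
    where
    open ≡-Reasoning
    count : List A → ℕ
    count xs = length (filter (T? ∘ p) xs)

≡ᵇ-refl : ∀ n → (n ≡ᵇ n) ≡ true
≡ᵇ-refl n = Equivalence.to T-≡ (≡⇒≡ᵇ n n refl)

≢⇒≡ᵇ-false : ∀ {m n} → m ≢ n → (m ≡ᵇ n) ≡ false
≢⇒≡ᵇ-false {m} {n} m≢n with m ≡ᵇ n in eq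
... | false = refl
... | true  = ⊥-elim (m≢n (≡ᵇ⇒≡ m n (subst T (sym eq) _)))

<⇒<ᵇ-true : ∀ {m n} → m < n → (m <ᵇ n) ≡ true
<⇒<ᵇ-true m<n = Equivalence.to T-≡ (<⇒<ᵇ m<n)

≥⇒<ᵇ-false : ∀ {m n} → n ≤ m → (m <ᵇ n) ≡ false
≥⇒<ᵇ-false {m} {n} n≤m with m <ᵇ n in eq
... | false = refl
... | true  = ⊥-elim (≤⇒≯ n≤m (<ᵇ⇒< m n (subst T (sym eq) _)))

ascTriangle : (ℕ → ℕ → Bool) → ℕ → ℕ → ℕ → Bool
ascTriangle A a b c = (a <ᵇ b) ∧ (b <ᵇ c) ∧ A a b ∧ A b c ∧ A a c

ascTriangle-unorderedˡ : ∀ A {a b} c → b ≤ a → ascTriangle A a b c ≡ false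
ascTriangle-unorderedˡ A c b≤a rewrite ≥⇒<ᵇ-false b≤a = refl

ascTriangle-unorderedʳ : ∀ A a {b c} → c ≤ b → ascTriangle A a b c ≡ false
ascTriangle-unorderedʳ A a {b} c≤b rewrite ≥⇒<ᵇ-false c≤b = ∧-zeroʳ (a <ᵇ b)

#triangles : (ℕ → ℕ → Bool) → ℕ → ℕ
#triangles A k = ∑[ a < k ] ∑[ b < k ] ∑[ c < k ] toℕ (ascTriangle A a b c)

#trianglesTopAt : (ℕ → ℕ → Bool) → ℕ → ℕ
#trianglesTopAt A k = ∑[ a < k ] ∑[ b < k ] toℕ (ascTriangle A a b k)

length-triangles : ∀ G → length (triangles G) ≡ #triangles (adj G) (size G)
length-triangles G =
  trans (length-filter-concatMap (isTriangle G) _ s id) (sumBelow-cong s λ a _ →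
  trans (length-filter-concatMap (isTriangle G) _ s id) (sumBelow-cong s λ b _ →
  trans (length-filter-map (isTriangle G) _ s id) (sumBelow-cong s λ c c<s →
  cong toℕ (isTriangle≡ascTriangle a b c<s))))
  where
  s : ℕ
  s = size G
  isTriangle≡ascTriangle : ∀ a b {c} → c < s → isTriangle G (a , b , c) ≡ ascTriangle (adj G) a b c
  isTriangle≡ascTriangle a b c<s rewrite <⇒<ᵇ-true c<s = refl

#triangles-cong : ∀ k {A B : ℕ → ℕ → Bool} → (∀ a b → a < k → b < k → A a b ≡ B a b) →
                  #triangles A k ≡ #triangles B k
#triangles-cong k A≗B = sumBelow-cong k λ a a<k → sumBelow-cong k λ b b<k → sumBelow-cong k λ c c<k →
  cong toℕ (cong₂ (λ x y → (a <ᵇ b) ∧ (b <ᵇ c) ∧ x ∧ y) (A≗B a b a<k b<k)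
                  (cong₂ _∧_ (A≗B b c b<k c<k) (A≗B a c a<k c<k)))

#triangles-suc : ∀ A k → #triangles A (suc k) ≡ #triangles A k + #trianglesTopAt A k
#triangles-suc A k = begin
    sumBelow k row + row k
  ≡⟨ cong (sumBelow k row +_) row-top ⟩
    sumBelow k row + 0
  ≡⟨ +-identityʳ _ ⟩
    sumBelow k row
  ≡⟨ sumBelow-cong k (λ a _ → row-split a) ⟩
    ∑[ a < k ] (∑[ b < k ] ∑[ c < k ] X a b c + ∑[ b < k ] X a b k)
  ≡⟨ sumBelow-distrib-+ k _ _ ⟩
    #triangles A k + #trianglesTopAt A k ∎
  where
  open ≡-Reasoning
  X : ℕ → ℕ → ℕ → ℕ
  X a b c = toℕ (ascTriangle A a b c)
  row : ℕ → ℕ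
  row a = ∑[ b < suc k ] ∑[ c < suc k ] X a b c
  row-top : row k ≡ 0
  row-top = sumBelow-zero (suc k) λ b b<1+k → sumBelow-zero (suc k) λ c _ →
    cong toℕ (ascTriangle-unorderedˡ A c (s≤s⁻¹ b<1+k))
  row-split : ∀ a → row a ≡ ∑[ b < k ] ∑[ c < k ] X a b c + ∑[ b < k ] X a b k
  row-split a = begin
      ∑[ b < k ] ∑[ c < suc k ] X a b c + ∑[ c < suc k ] X a k c
    ≡⟨ cong (∑[ b < k ] ∑[ c < suc k ] X a b c +_) (sumBelow-zero (suc k) λ c c<1+k → cong toℕ (ascTriangle-unorderedʳ A a (s≤s⁻¹ c<1+k))) ⟩
      ∑[ b < k ] ∑[ c < suc k ] X a b c + 0
    ≡⟨ +-identityʳ _ ⟩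
      ∑[ b < k ] (∑[ c < k ] X a b c + X a b k)
    ≡⟨ sumBelow-distrib-+ k _ _ ⟩
      ∑[ b < k ] ∑[ c < k ] X a b c + ∑[ b < k ] X a b k ∎

module _ (A : ℕ → ℕ → Bool) (k : ℕ) where
  private
    X : ℕ → ℕ → ℕ
    X a b = toℕ (ascTriangle A a b k)

    X-adjacent : ∀ {a b} → a < b → b < k → A a k ≡ true → A b k ≡ true → X a b ≡ toℕ (A a b)
    X-adjacent {a} {b} a<b b<k a~k b~k rewrite <⇒<ᵇ-true a<b | <⇒<ᵇ-true b<k | a~k | b~k =
      cong toℕ (∧-identityʳ (A a b))

    X-unordered : ∀ a b → b ≤ a → X a b ≡ 0
    X-unordered a b b≤a = cong toℕ (ascTriangle-unorderedˡ A k b≤a)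

    X-nonadjacentˡ : ∀ a b → A a k ≡ false → X a b ≡ 0
    X-nonadjacentˡ a b a≁k rewrite a≁k | ∧-zeroʳ (A b k) | ∧-zeroʳ (A a b) | ∧-zeroʳ (b <ᵇ k)
      | ∧-zeroʳ (a <ᵇ b) = refl

    X-nonadjacentʳ : ∀ a b → A b k ≡ false → X a b ≡ 0
    X-nonadjacentʳ a b b≁k rewrite b≁k | ∧-zeroʳ (A a b) | ∧-zeroʳ (b <ᵇ k) | ∧-zeroʳ (a <ᵇ b) = refl

  #trianglesTopAt-two : ∀ {p q} → p < q → q < k → A p k ≡ true → A q k ≡ true →
                        (∀ a → a < k → a ≢ p → a ≢ q → A a k ≡ false) →
                        #trianglesTopAt A k ≡ toℕ (A p q)
  #trianglesTopAt-two {p} {q} p<q q<k p~k q~k others = begin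
      #trianglesTopAt A k
    ≡⟨ sumBelow-support₂ k row p<q q<k (λ a a<k a≢p a≢q →
         sumBelow-zero k λ b _ → X-nonadjacentˡ a b (others a a<k a≢p a≢q)) ⟩
      row p + row q
    ≡⟨ cong₂ _+_ row-p row-q ⟩
      toℕ (A p q) + 0
    ≡⟨ +-identityʳ _ ⟩
      toℕ (A p q) ∎
    where
    open ≡-Reasoning
    row : ℕ → ℕ
    row a = ∑[ b < k ] X a b
    row-support : ∀ a → row a ≡ X a p + X a q
    row-support a = sumBelow-support₂ k (X a) p<q q<k λ b b<k b≢p b≢q →
      X-nonadjacentʳ a b (others b b<k b≢p b≢q)
    row-p : row p ≡ toℕ (A p q)
    row-p rewrite row-support p | X-unordered p p ≤-refl | X-adjacent p<q q<k p~k q~k = refl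
    row-q : row q ≡ 0
    row-q rewrite row-support q | X-unordered q p (<⇒≤ p<q) | X-unordered q q ≤-refl = refl

  #trianglesTopAt-three : ∀ {p q r} → p < q → q < r → r < k →
                          A p k ≡ true → A q k ≡ true → A r k ≡ true →
                          (∀ a → a < k → a ≢ p → a ≢ q → a ≢ r → A a k ≡ false) →
                          #trianglesTopAt A k ≡ toℕ (A p q) + toℕ (A p r) + toℕ (A q r)
  #trianglesTopAt-three {p} {q} {r} p<q q<r r<k p~k q~k r~k others = begin
      #trianglesTopAt A k
    ≡⟨ sumBelow-support₃ k row p<q q<r r<k (λ a a<k a≢p a≢q a≢r →
         sumBelow-zero k λ b _ → X-nonadjacentˡ a b (others a a<k a≢p a≢q a≢r)) ⟩
      row p + row q + row r
    ≡⟨ cong₂ _+_ (cong₂ _+_ row-p row-q) row-r ⟩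
      toℕ (A p q) + toℕ (A p r) + toℕ (A q r) + 0
    ≡⟨ +-identityʳ _ ⟩
      toℕ (A p q) + toℕ (A p r) + toℕ (A q r) ∎
    where
    open ≡-Reasoning
    p<r : p < r
    p<r = <-trans p<q q<r
    row : ℕ → ℕ
    row a = ∑[ b < k ] X a b
    row-support : ∀ a → row a ≡ X a p + X a q + X a r
    row-support a = sumBelow-support₃ k (X a) p<q q<r r<k λ b b<k b≢p b≢q b≢r →
      X-nonadjacentʳ a b (others b b<k b≢p b≢q b≢r)
    row-p : row p ≡ toℕ (A p q) + toℕ (A p r)
    row-p rewrite row-support p | X-unordered p p ≤-refl | X-adjacent p<q (<-trans q<r r<k) p~k q~k
      | X-adjacent p<r r<k p~k r~k = refl
    row-q : row q ≡ toℕ (A q r)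
    row-q rewrite row-support q | X-unordered q p (<⇒≤ p<q) | X-unordered q q ≤-refl
      | X-adjacent q<r r<k q~k r~k = refl
    row-r : row r ≡ 0
    row-r rewrite row-support r | X-unordered r p (<⇒≤ p<r) | X-unordered r q (<⇒≤ q<r)
      | X-unordered r r ≤-refl = refl

joins : ℕ × ℕ → ℕ → ℕ → Bool
joins (p , q) u v = ((p ≡ᵇ u) ∧ (q ≡ᵇ v)) ∨ ((p ≡ᵇ v) ∧ (q ≡ᵇ u))

joins-refl : ∀ p q → joins (p , q) p q ≡ true
joins-refl p q rewrite ≡ᵇ-refl p | ≡ᵇ-refl q = refl

joins-swap : ∀ p q → joins (p , q) q p ≡ true
joins-swap p q rewrite ≡ᵇ-refl p | ≡ᵇ-refl q = ∨-zeroʳ _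

joins-false : ∀ {p q u v} → p ≢ u ⊎ q ≢ v → p ≢ v ⊎ q ≢ u → joins (p , q) u v ≡ false
joins-false {p} {q} {u} {v} direct swapped = cong₂ _∨_ (both direct) (both swapped)
  where
  both : ∀ {a b c d} → a ≢ c ⊎ b ≢ d → (a ≡ᵇ c) ∧ (b ≡ᵇ d) ≡ false
  both (inj₁ a≢c) rewrite ≢⇒≡ᵇ-false a≢c = refl
  both (inj₂ b≢d) rewrite ≢⇒≡ᵇ-false b≢d = ∧-zeroʳ _

adj-true : ∀ G {u v e} → e ∈ edges G → joins e u v ≡ true → adj G u v ≡ true
adj-true G {u} {v} = any-true (edges G)
  where
  any-true : ∀ es {e} → e ∈ es → joins e u v ≡ true → any (λ e → joins e u v) es ≡ true
  any-true (e ∷ es) (here refl)  e~ rewrite e~ = refl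
  any-true (e ∷ es) (there e∈es) e~ rewrite any-true es e∈es e~ = ∨-zeroʳ (joins e u v)

adj-false : ∀ G {u v} → (∀ {p q} → (p , q) ∈ edges G → joins (p , q) u v ≡ false) → adj G u v ≡ false
adj-false G {u} {v} = any-false (edges G)
  where
  any-false : ∀ es → (∀ {p q} → (p , q) ∈ es → joins (p , q) u v ≡ false) →
              any (λ e → joins e u v) es ≡ false
  any-false []       _  = refl
  any-false (e ∷ es) ≁ rewrite ≁ (here refl) = any-false es (≁ ∘ there)

WellSized : Graph → Set
WellSized G = ∀ {p q} → (p , q) ∈ edges G → p < size G × q < size G

∈-triangles⇒ : ∀ G {x y z} → (x , y , z) ∈ triangles G →
  x < y × y < z × z < size G × adj G x y ≡ true × adj G y z ≡ true × adj G x z ≡ true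
∈-triangles⇒ G {x} {y} {z} t∈ =
  let t = proj₂ (∈-filter⁻ (T? ∘ isTriangle G) {xs = allTriples (size G)} t∈)
      (x<y , t₁) = split t; (y<z , t₂) = split t₁; (z<size , t₃) = split t₂; (x~y , t₄) = split t₃
      (y~z , x~z) = split t₄
  in <ᵇ⇒< x y x<y , <ᵇ⇒< y z y<z , <ᵇ⇒< z (size G) z<size , true≡ x~y , true≡ y~z , true≡ x~z
  where
  split : ∀ {a b} → T (a ∧ b) → T a × T b
  split = Equivalence.to T-∧
  true≡ : ∀ {a} → T a → a ≡ true
  true≡ = Equivalence.to T-≡

module _ (G : Graph) (ws : WellSized G) {x y z} (x<y : x < y) (y<z : y < z) (z<s : z < size G)
         (x~y : adj G x y ≡ true) (y~z : adj G y z ≡ true) (x~z : adj G x z ≡ true) where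
  private
    s : ℕ
    s = size G
    G' : Graph
    G' = extend G (x , y , z)
    y<s : y < s
    y<s = <-trans y<z z<s
    x<s : x < s
    x<s = <-trans x<y y<s

  wellSized-extend : WellSized G'
  wellSized-extend (here refl)                 = n<1+n s , m<n⇒m<1+n x<s
  wellSized-extend (there (here refl))         = n<1+n s , m<n⇒m<1+n y<s
  wellSized-extend (there (there (here refl))) = n<1+n s , m<n⇒m<1+n z<s
  wellSized-extend (there (there (there e∈)))  = m<n⇒m<1+n (proj₁ (ws e∈)) , m<n⇒m<1+n (proj₂ (ws e∈))

  private
    new-edge-avoids : ∀ {u v} w → u < s → v < s → joins (s , w) u v ≡ false
    new-edge-avoids w u<s v<s = joins-false {q = w} (inj₁ (>⇒≢ u<s)) (inj₁ (>⇒≢ v<s))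

    adj-old : ∀ {u v} → u < s → v < s → adj G' u v ≡ adj G u v
    adj-old {u} {v} u<s v<s = cong₂ _∨_ (avoid x) (cong₂ _∨_ (avoid y) (cong₂ _∨_ (avoid z) refl))
      where
      avoid : ∀ w → joins (s , w) u v ≡ false
      avoid w = new-edge-avoids w u<s v<s

    adj-new : ∀ {u} → u < s → u ≢ x → u ≢ y → u ≢ z → adj G' u s ≡ false
    adj-new {u} u<s u≢x u≢y u≢z = adj-false G' λ where
      (here refl)                 → joins-false (inj₁ (>⇒≢ u<s)) (inj₂ (u≢x ∘ sym))
      (there (here refl))         → joins-false (inj₁ (>⇒≢ u<s)) (inj₂ (u≢y ∘ sym))
      (there (there (here refl))) → joins-false (inj₁ (>⇒≢ u<s)) (inj₂ (u≢z ∘ sym))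
      (there (there (there e∈)))  → joins-false (inj₂ (<⇒≢ (proj₂ (ws e∈)))) (inj₁ (<⇒≢ (proj₁ (ws e∈))))

    topAt-new : #trianglesTopAt (adj G') s ≡ 3
    topAt-new rewrite #trianglesTopAt-three (adj G') s x<y y<z z<s
        (adj-true G' (here refl) (joins-swap s x))
        (adj-true G' (there (here refl)) (joins-swap s y))
        (adj-true G' (there (there (here refl))) (joins-swap s z))
        (λ a a<s → adj-new a<s)
      | adj-old x<s y<s | adj-old x<s z<s | adj-old y<s z<s | x~y | x~z | y~z = refl

  length-triangles-extend : length (triangles G') ≡ length (triangles G) + 3
  length-triangles-extend = begin
      length (triangles G')
    ≡⟨ length-triangles G' ⟩
      #triangles (adj G') (suc s)
    ≡⟨ #triangles-suc (adj G') s ⟩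
      #triangles (adj G') s + #trianglesTopAt (adj G') s
    ≡⟨ cong₂ _+_ (#triangles-cong s λ a b a<s b<s → adj-old a<s b<s) topAt-new ⟩
      #triangles (adj G) s + 3
    ≡⟨ cong (_+ 3) (length-triangles G) ⟨
      length (triangles G) + 3 ∎
    where open ≡-Reasoning

length-triangles-build : ∀ G {used} ts → WellSized G → ValidChoices G used ts →
                         length (triangles (build G ts)) ≡ length (triangles G) + 3 * length ts
length-triangles-build G []                  _  _                = sym (+-identityʳ _)
length-triangles-build G ((x , y , z) ∷ ts) ws (t∈ , _ , valid)
  with x<y , y<z , z<size , x~y , y~z , x~z ← ∈-triangles⇒ G t∈ = begin
    length (triangles (build G' ts))
  ≡⟨ length-triangles-build G' ts (wellSized-extend G ws x<y y<z z<size x~y y~z x~z) valid ⟩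
    length (triangles G') + 3 * length ts
  ≡⟨ cong (_+ 3 * length ts) (length-triangles-extend G ws x<y y<z z<size x~y y~z x~z) ⟩
    length (triangles G) + 3 + 3 * length ts
  ≡⟨ +-assoc (length (triangles G)) 3 _ ⟩
    length (triangles G) + (3 + 3 * length ts)
  ≡⟨ cong (length (triangles G) +_) (*-suc 3 (length ts)) ⟨
    length (triangles G) + 3 * suc (length ts) ∎
  where
  open ≡-Reasoning
  G' : Graph
  G' = extend G (x , y , z)

m+n<o⇒n<o∸m : ∀ m {n o} → m + n < o → n < o ∸ m
m+n<o⇒n<o∸m zero    lt             = lt
m+n<o⇒n<o∸m (suc m) {o = suc o} lt = m+n<o⇒n<o∸m m (s≤s⁻¹ lt)

n<o∸m⇒m+n<o : ∀ m {n o} → n < o ∸ m → m + n < o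
n<o∸m⇒m+n<o zero                lt = lt
n<o∸m⇒m+n<o (suc m) {o = suc o} lt = s≤s (n<o∸m⇒m+n<o m lt)

data WheelEdge (m : ℕ) : ℕ × ℕ → Set where
  spoke   : ∀ {i} → suc i < m → WheelEdge m (0 , suc i)
  rim     : ∀ {i} → 2 + i < m → WheelEdge m (suc i , 2 + i)
  closing : WheelEdge m (m ∸ 1 , 1)

∈-wheel⁻ : ∀ m {e} → e ∈ edges (wheel m) → WheelEdge m e
∈-wheel⁻ m e∈ with ∈-++⁻ (map (λ i → (0 , suc i)) (upTo (m ∸ 1))) e∈
... | inj₁ e∈spokes with i , i∈ , refl ← ∈-map⁻ (λ i → (0 , suc i)) e∈spokes =
  spoke (n<o∸m⇒m+n<o 1 (∈-upTo⁻ i∈))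
... | inj₂ e∈rest with ∈-++⁻ (map (λ i → (suc i , 2 + i)) (upTo (m ∸ 2))) e∈rest
...   | inj₁ e∈rim with i , i∈ , refl ← ∈-map⁻ (λ i → (suc i , 2 + i)) e∈rim =
  rim (n<o∸m⇒m+n<o 2 (∈-upTo⁻ i∈))
...   | inj₂ (here refl) = closing

∈-wheel⁺ : ∀ {m e} → WheelEdge m e → e ∈ edges (wheel m)
∈-wheel⁺ {m} (spoke lt) = ∈-++⁺ˡ (∈-map⁺ (λ i → (0 , suc i)) (∈-upTo⁺ (m+n<o⇒n<o∸m 1 lt)))
∈-wheel⁺ {m} (rim lt)   = ∈-++⁺ʳ (map (λ i → (0 , suc i)) (upTo (m ∸ 1)))
  (∈-++⁺ˡ (∈-map⁺ (λ i → (suc i , 2 + i)) (∈-upTo⁺ (m+n<o⇒n<o∸m 2 lt))))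
∈-wheel⁺ {m} closing    = ∈-++⁺ʳ (map (λ i → (0 , suc i)) (upTo (m ∸ 1)))
  (∈-++⁺ʳ (map (λ i → (suc i , 2 + i)) (upTo (m ∸ 2))) (here refl))

wellSized-wheel : ∀ {m} → 2 ≤ m → WellSized (wheel m)
wellSized-wheel {m} 2≤m e∈ with ∈-wheel⁻ m e∈
... | spoke lt = <-trans z<s lt , lt
... | rim lt   = <-trans (n<1+n _) lt , lt
... | closing  = ∸-monoʳ-< z<s (<-trans z<s 2≤m) , 2≤m

module _ {m : ℕ} where

  adj-wheel-spoke : ∀ {i} → suc i < m → adj (wheel m) 0 (suc i) ≡ true
  adj-wheel-spoke {i} lt = adj-true (wheel m) (∈-wheel⁺ (spoke lt)) (joins-refl 0 (suc i))

  adj-wheel-rim : ∀ {i} → 2 + i < m → adj (wheel m) (suc i) (2 + i) ≡ true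
  adj-wheel-rim {i} lt = adj-true (wheel m) (∈-wheel⁺ (rim lt)) (joins-refl (suc i) (2 + i))

  adj-wheel-closing : adj (wheel m) 1 (m ∸ 1) ≡ true
  adj-wheel-closing = adj-true (wheel m) (∈-wheel⁺ {m} closing) (joins-swap (m ∸ 1) 1)

  adj-wheel-chord : ∀ {a k} → 1 ≤ a → suc a < k → (k ≡ m ∸ 1 → a ≢ 1) → adj (wheel m) a k ≡ false
  adj-wheel-chord {a} {k} 1≤a 1+a<k not-closing = adj-false (wheel m) λ e∈ → avoid (∈-wheel⁻ m e∈)
    where
    a<k : a < k
    a<k = <-trans (n<1+n a) 1+a<k
    avoid : ∀ {p q} → WheelEdge m (p , q) → joins (p , q) a k ≡ false
    avoid (spoke {i} _) = joins-false {q = suc i} (inj₁ (<⇒≢ 1≤a)) (inj₁ (<⇒≢ (<-trans 1≤a a<k)))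
    avoid (rim {i} _) = joins-false direct swapped
      where
      direct : suc i ≢ a ⊎ 2 + i ≢ k
      direct with suc i ≟ a
      ... | yes refl = inj₂ (<⇒≢ 1+a<k)
      ... | no  i≢a  = inj₁ i≢a
      swapped : suc i ≢ k ⊎ 2 + i ≢ a
      swapped with suc i ≟ k
      ... | yes refl = inj₂ (>⇒≢ (m<n⇒m<1+n a<k))
      ... | no  i≢k  = inj₁ i≢k
    avoid closing = joins-false (inj₂ (<⇒≢ (<-≤-trans (s≤s 1≤a) (<⇒≤ 1+a<k)))) swapped
      where
      swapped : m ∸ 1 ≢ k ⊎ 1 ≢ a
      swapped with m ∸ 1 ≟ k
      ... | yes last≡k = inj₂ (not-closing (sym last≡k) ∘ sym)
      ... | no  last≢k = inj₁ last≢k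

module _ (j : ℕ) (A : ℕ → ℕ → Bool)
         (spoke   : ∀ {i} → suc i < 5 + j → A 0 (suc i) ≡ true)
         (rim     : ∀ {i} → 2 + i < 5 + j → A (suc i) (2 + i) ≡ true)
         (closing : A 1 (4 + j) ≡ true)
         (chord   : ∀ {a k} → 1 ≤ a → suc a < k → (k ≡ 4 + j → a ≢ 1) → A a k ≡ false) where
  private
    topAt-rim : ∀ i → 3 + i < 5 + j → #trianglesTopAt A (2 + i) ≡ 1
    topAt-rim i lt = trans (#trianglesTopAt-two A (2 + i) z<s (n<1+n (suc i)) (spoke lt′) (rim lt′) others)
                           (cong toℕ (spoke (<-trans (n<1+n _) lt′)))
      where
      lt′ : 2 + i < 5 + j
      lt′ = <-trans (n<1+n _) lt
      others : ∀ a → a < 2 + i → a ≢ 0 → a ≢ suc i → A a (2 + i) ≡ false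
      others zero    _     a≢0 _   = ⊥-elim (a≢0 refl)
      others (suc a) a<2+i _   a≢i = chord (s≤s z≤n) (s≤s (≤∧≢⇒< (s≤s⁻¹ a<2+i) a≢i))
                                           (λ 2+i≡4+j → ⊥-elim (<⇒≢ lt (cong suc 2+i≡4+j)))

    topAt-last : #trianglesTopAt A (4 + j) ≡ 2
    topAt-last = begin
        #trianglesTopAt A (4 + j)
      ≡⟨ #trianglesTopAt-three A (4 + j) z<s (s≤s z<s) (n<1+n _) (spoke (n<1+n _)) closing (rim (n<1+n _)) others ⟩
        toℕ (A 0 1) + toℕ (A 0 (3 + j)) + toℕ (A 1 (3 + j))
      ≡⟨ cong₂ _+_ (cong₂ _+_ (cong toℕ (spoke (s≤s (s≤s z≤n)))) (cong toℕ (spoke (<-trans (n<1+n _) (n<1+n _)))))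
                   (cong toℕ (chord (s≤s z≤n) (s≤s (s≤s (s≤s z≤n))) (⊥-elim ∘ <⇒≢ (n<1+n _)))) ⟩
        2 ∎
      where
      open ≡-Reasoning
      others : ∀ a → a < 4 + j → a ≢ 0 → a ≢ 1 → a ≢ 3 + j → A a (4 + j) ≡ false
      others zero    _     a≢0 _   _     = ⊥-elim (a≢0 refl)
      others (suc a) a<4+j _   a≢1 a≢3+j = chord (s≤s z≤n) (s≤s (≤∧≢⇒< (s≤s⁻¹ a<4+j) a≢3+j)) (λ _ → a≢1)

    #triangles-rim : ∀ i → 2 + i ≤ 4 + j → #triangles A (2 + i) ≡ i
    #triangles-rim zero    _  = refl
    #triangles-rim (suc i) le = begin
        #triangles A (3 + i)
      ≡⟨ #triangles-suc A (2 + i) ⟩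
        #triangles A (2 + i) + #trianglesTopAt A (2 + i)
      ≡⟨ cong₂ _+_ (#triangles-rim i (≤-trans (n≤1+n _) le)) (topAt-rim i (s≤s le)) ⟩
        i + 1
      ≡⟨ +-comm i 1 ⟩
        suc i ∎
      where open ≡-Reasoning

  #triangles-wheelLike : #triangles A (5 + j) ≡ 4 + j
  #triangles-wheelLike = begin
      #triangles A (5 + j)
    ≡⟨ #triangles-suc A (4 + j) ⟩
      #triangles A (4 + j) + #trianglesTopAt A (4 + j)
    ≡⟨ cong₂ _+_ (#triangles-rim (2 + j) ≤-refl) topAt-last ⟩
      2 + j + 2
    ≡⟨ +-comm (2 + j) 2 ⟩
      4 + j ∎
    where open ≡-Reasoning

length-triangles-wheel : ∀ m → 4 < m → length (triangles (wheel m)) ≡ m ∸ 1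
length-triangles-wheel _ (s≤s (s≤s (s≤s (s≤s (s≤s {n = j} z≤n))))) =
  trans (length-triangles (wheel (5 + j)))
        (#triangles-wheelLike j (adj (wheel (5 + j))) adj-wheel-spoke adj-wheel-rim
                                 (adj-wheel-closing {5 + j}) (adj-wheel-chord {5 + j}))

-- W₄ is K₄: its rim is itself a 3-cycle, one more than the m - 1 of a larger wheel.
length-triangles-wheel₄ : length (triangles (wheel 4)) ≡ 4
length-triangles-wheel₄ = refl

length-triangles-WRAG : ∀ {m n G} → 2 ≤ m → IsWRAG m n G →
                        length (triangles G) ≡ length (triangles (wheel m)) + 3 * (n ∸ m)
length-triangles-WRAG {m} 2≤m (ts , len , valid , refl) =
  trans (length-triangles-build (wheel m) ts (wellSized-wheel 2≤m) valid)
        (cong (λ l → length (triangles (wheel m)) + 3 * l) len)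

w+3*[n∸m]≡3*n∸c : ∀ w c {m n} → m ≤ n → (∀ d → 3 * (m + d) ≡ c + (w + 3 * d)) → w + 3 * (n ∸ m) ≡ 3 * n ∸ c
w+3*[n∸m]≡3*n∸c w c {m} {n} m≤n expand = begin
    w + 3 * (n ∸ m)
  ≡⟨ m+n∸m≡n c _ ⟨
    c + (w + 3 * (n ∸ m)) ∸ c
  ≡⟨ cong (_∸ c) (expand (n ∸ m)) ⟨
    3 * (m + (n ∸ m)) ∸ c
  ≡⟨ cong (λ l → 3 * l ∸ c) (m+[n∸m]≡n m≤n) ⟩
    3 * n ∸ c ∎
  where open ≡-Reasoning

expand-4 : ∀ d → 3 * (4 + d) ≡ 8 + (4 + 3 * d)
expand-4 = solve-∀

expand-1+ : ∀ {m} → 1 ≤ m → ∀ d → 3 * (m + d) ≡ 2 * m + 1 + (m ∸ 1 + 3 * d)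
expand-1+ {suc k} _ = expand k
  where
  expand : ∀ k d → 3 * (suc k + d) ≡ 2 * suc k + 1 + (k + 3 * d)
  expand = solve-∀

mainTheorem3 : (m n : ℕ) → 4 ≤ m → m < n → (G : Graph) → IsWRAG m n G →
    (m ≡ 4 → length (triangles G) ≡ 3 * n ∸ 8) ×
    (4 < m → length (triangles G) ≡ 3 * n ∸ (2 * m + 1))
mainTheorem3 m n 4≤m m<n G wrag = seed₄ , larger
  where
  counted : length (triangles G) ≡ length (triangles (wheel m)) + 3 * (n ∸ m)
  counted = length-triangles-WRAG (≤-trans (s≤s (s≤s z≤n)) 4≤m) wrag
  seed₄ : m ≡ 4 → length (triangles G) ≡ 3 * n ∸ 8
  seed₄ refl = trans counted (trans (cong (_+ 3 * (n ∸ 4)) length-triangles-wheel₄)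
                                   (w+3*[n∸m]≡3*n∸c 4 8 (<⇒≤ m<n) expand-4))
  larger : 4 < m → length (triangles G) ≡ 3 * n ∸ (2 * m + 1)
  larger 4<m = begin
      length (triangles G)
    ≡⟨ counted ⟩
      length (triangles (wheel m)) + 3 * (n ∸ m)
    ≡⟨ cong (_+ 3 * (n ∸ m)) (length-triangles-wheel m 4<m) ⟩
      m ∸ 1 + 3 * (n ∸ m)
    ≡⟨ w+3*[n∸m]≡3*n∸c (m ∸ 1) (2 * m + 1) (<⇒≤ m<n) (expand-1+ (<-trans z<s 4<m)) ⟩
      3 * n ∸ (2 * m + 1) ∎
    where open ≡-Reasoning
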